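{- Let $T=(Q,\Sigma,\Gamma,\delta,q_0,F)$ be a nondeterministic finite transducer. Then $T$ has bounded variation if and only if there exists $t\in\mathbb{N}$ such that for all $q_1,q_2\in Q$, $f_1,f_2\in F$, $a,b_1,b_2\in\Sigma^\ast$ and $u,v_1,v_2,w_1,w_2\in\Gamma^\ast$: if $q_0\xrightarrow{a/uv_1}q_1\xrightarrow{b_1/w_1}f_1$ and $q_0\xrightarrow{a/uv_2}q_2\xrightarrow{b_2/w_2}f_2$, then $d(v_1,v_2)\le t$.
   Context: An NFT is a sextuple $T=(Q,\Sigma,\Gamma,\delta,q_0,F)$ with a finite nonempty state set $Q$, finite nonempty input alphabet $\Sigma$, finite nonempty output alphabet $\Gamma$, initial state $q_0\in Q$, accepting states $F\subseteq Q$, and transition function $\delta$ mapping each $(q,\sigma)\in Q\times\Sigma$ to a finite subset of $Q\times\Gamma^\ast$. We write $q\xrightarrow{a/u}q'$ if $T$ can go from $q$ to $q'$ while reading $a\in\Sigma^\ast$ and producing $u\in\Gamma^\ast$, the concatenation of the outputs of the individual transitions (for $a$ empty, $q'=q$ and $u$ empty). For words $v_1,v_2$, $d(v_1,v_2)=|v_1|+|v_2|-2|\mathrm{lcp}(v_1,v_2)|$ where $\mathrm{lcp}$ is the longest common prefix. $T$ has bounded variation (for transducers) if for every $k\in\mathbb{N}$ there exists $t\in\mathbb{N}$ such that for all $q_1,q_2\in Q$, $f_1,f_2\in F$, $a,b_1,b_2\in\Sigma^\ast$, $u,v_1,v_2,w_1,w_2\in\Gamma^\ast$: if $q_0\xrightarrow{a/uv_1}q_1\xrightarrow{b_1/w_1}f_1$,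 $q_0\xrightarrow{a/uv_2}q_2\xrightarrow{b_2/w_2}f_2$ and $|b_1|+|b_2|\le k$, then $d(v_1w_1,v_2w_2)\le t$. -}

module Defs where

open import Data.Nat using (ℕ; suc; _+_; _*_; _≤_)
open import Data.Fin using (Fin)
open import Data.Bool using (Bool; true)
open import Data.List using (List; []; _∷_; _++_; length)
open import Data.List.Membership.Propositional using (_∈_)
open import Data.Product using (_×_; _,_; Σ; ∃)
open import Relation.Binary.PropositionalEquality using (_≡_)

-- Q = Fin (suc nQ), Σ = Fin (suc nΣ), Γ = Fin (suc nΓ): finite and nonempty.
-- δ q σ is a finite list (= finite subset) of pairs (q', output word).
record NFT : Set where
  field
    nQ nΣ nΓ : ℕ
    δ        : Fin (suc nQ) → Fin (suc nΣ) → List (Fin (suc nQ) × List (Fin (suc nΓ)))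
    q₀       : Fin (suc nQ)
    F        : Fin (suc nQ) → Bool

  State = Fin (suc nQ)
  In    = Fin (suc nΣ)
  Out   = Fin (suc nΓ)

  Accepting : State → Set
  Accepting q = F q ≡ true

  data Step : State → List In → List Out → State → Set where
    done : ∀ {q} → Step q [] [] q
    step : ∀ {q q' q'' σ a x u} →
           (q' , x) ∈ δ q σ → Step q' a u q'' → Step q (σ ∷ a) (x ++ u) q''

lcpLen : ∀ {A : Set} → (A → A → Bool) → List A → List A → ℕ
lcpLen _  []       _        = 0
lcpLen _  (_ ∷ _)  []       = 0
lcpLen eq (x ∷ xs) (y ∷ ys) with eq x y
... | true  = suc (lcpLen eq xs ys)
... | _     = 0

open import Data.Fin using (_≟_)
open import Relation.Nullary.Decidable using (⌊_⌋)
open import Data.Nat using (_∸_)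

dist : ∀ {n} → List (Fin n) → List (Fin n) → ℕ
dist v₁ v₂ = (length v₁ + length v₂) ∸ (2 * lcpLen (λ x y → ⌊ x ≟ y ⌋) v₁ v₂)

module _ (T : NFT) where
  open NFT T

  BoundedVariation : Set
  BoundedVariation =
    ∀ (k : ℕ) → ∃ λ (t : ℕ) →
      ∀ (q₁ q₂ f₁ f₂ : State) → Accepting f₁ → Accepting f₂ →
      ∀ (a b₁ b₂ : List In) (u v₁ v₂ w₁ w₂ : List Out) →
      Step q₀ a (u ++ v₁) q₁ → Step q₁ b₁ w₁ f₁ →
      Step q₀ a (u ++ v₂) q₂ → Step q₂ b₂ w₂ f₂ →
      length b₁ + length b₂ ≤ k →
      dist (v₁ ++ w₁) (v₂ ++ w₂) ≤ t

  BoundedPrefixDelay : Set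
  BoundedPrefixDelay =
    ∃ λ (t : ℕ) →
      ∀ (q₁ q₂ f₁ f₂ : State) → Accepting f₁ → Accepting f₂ →
      ∀ (a b₁ b₂ : List In) (u v₁ v₂ w₁ w₂ : List Out) →
      Step q₀ a (u ++ v₁) q₁ → Step q₁ b₁ w₁ f₁ →
      Step q₀ a (u ++ v₂) q₂ → Step q₂ b₂ w₂ f₂ →
      dist v₁ v₂ ≤ t

-- Appending w₁, w₂ to v₁, v₂ changes d by at most |w₁| + |w₂|, so the two conditions differ only
-- by the output produced along the tails b₁, b₂.  Bounded prefix delay therefore gives bounded
-- variation with t + k·M, where M bounds the output of a single transition.  Conversely, removing
-- loops from the tails makes them of length at most |Q| - 1 without touching q₀ ─a→ qᵢ, and bounded
-- variation for k = 2(|Q| - 1) then bounds d(v₁, v₂) up to the output of these short tails.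
module Submission where

open import Defs
open import Function.Bundles using (_⇔_; mk⇔)
open import Data.Nat using (ℕ; suc; _+_; _*_; _≤_; z≤n; s≤s; s≤s⁻¹)
open import Data.Nat.Properties hiding (_≟_)
open import Data.Nat.ListAction using (sum)
open import Data.Nat.Tactic.RingSolver using (solve-∀)
open import Data.Fin using (Fin; _≟_)
open import Data.Bool using (Bool; true; false)
open import Data.List using (List; []; _∷_; _++_; length; map; allFin)
open import Data.List.Properties using (length-++; length-tabulate; length-removeAt′)
open import Data.List.Membership.Propositional using (_∈_)
open import Data.List.Membership.Propositional.Properties using (∈-allFin)
open import Data.List.Relation.Unary.Any using (here; there; _─_)
open import Data.List.Relation.Unary.All using ([]; _∷_)
import Data.List.Relation.Unary.All as All
open import Data.List.Relation.Unary.All.Properties using (¬Any⇒All¬)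
open import Data.List.Relation.Unary.Unique.Propositional using (Unique; []; _∷_)
open import Data.List.Relation.Binary.Subset.Propositional using (_⊆_)
open import Data.Product using (_×_; _,_; ∃₂; proj₂)
open import Relation.Nullary using (yes; no; contradiction)
open import Relation.Nullary.Decidable using (⌊_⌋)
open import Relation.Binary.PropositionalEquality
  using (_≡_; _≢_; refl; sym; cong; cong₂; subst; ≢-sym; module ≡-Reasoning)

module _ {A : Set} (eq : A → A → Bool) where

  lcpLen≤ˡ : ∀ xs ys → lcpLen eq xs ys ≤ length xs
  lcpLen≤ˡ []       _        = z≤n
  lcpLen≤ˡ (x ∷ xs) []       = z≤n
  lcpLen≤ˡ (x ∷ xs) (y ∷ ys) with eq x y
  ... | true  = s≤s (lcpLen≤ˡ xs ys)
  ... | false = z≤n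

  lcpLen≤ʳ : ∀ xs ys → lcpLen eq xs ys ≤ length ys
  lcpLen≤ʳ []       _        = z≤n
  lcpLen≤ʳ (x ∷ xs) []       = z≤n
  lcpLen≤ʳ (x ∷ xs) (y ∷ ys) with eq x y
  ... | true  = s≤s (lcpLen≤ʳ xs ys)
  ... | false = z≤n

  2*lcpLen≤length : ∀ xs ys → 2 * lcpLen eq xs ys ≤ length xs + length ys
  2*lcpLen≤length xs ys =
    subst (_≤ length xs + length ys) (cong (lcpLen eq xs ys +_) (sym (+-identityʳ _)))
      (+-mono-≤ (lcpLen≤ˡ xs ys) (lcpLen≤ʳ xs ys))

  lcpLen-++-mono : ∀ xs ys as bs → lcpLen eq xs ys ≤ lcpLen eq (xs ++ as) (ys ++ bs)
  lcpLen-++-mono []       _        _  _  = z≤n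
  lcpLen-++-mono (x ∷ xs) []       _  _  = z≤n
  lcpLen-++-mono (x ∷ xs) (y ∷ ys) as bs with eq x y
  ... | true  = s≤s (lcpLen-++-mono xs ys as bs)
  ... | false = z≤n

  lcpLen-++-≤ : ∀ xs ys as bs →
                lcpLen eq (xs ++ as) (ys ++ bs) ≤ lcpLen eq xs ys + (length as + length bs)
  lcpLen-++-≤ []       ys       as bs = ≤-trans (lcpLen≤ˡ as (ys ++ bs)) (m≤m+n _ _)
  lcpLen-++-≤ (x ∷ xs) []       as bs = ≤-trans (lcpLen≤ʳ (x ∷ xs ++ as) bs) (m≤n+m _ _)
  lcpLen-++-≤ (x ∷ xs) (y ∷ ys) as bs with eq x y
  ... | true  = s≤s (lcpLen-++-≤ xs ys as bs)
  ... | false = z≤n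

module _ {n : ℕ} where

  lcp : List (Fin n) → List (Fin n) → ℕ
  lcp = lcpLen (λ x y → ⌊ x ≟ y ⌋)

  dist+2*lcp : ∀ v₁ v₂ → dist v₁ v₂ + 2 * lcp v₁ v₂ ≡ length v₁ + length v₂
  dist+2*lcp v₁ v₂ = m∸n+n≡m (2*lcpLen≤length _ v₁ v₂)

  module _ (v₁ v₂ w₁ w₂ : List (Fin n)) where

    private
      B L L′ D D′ : ℕ
      B  = length w₁ + length w₂
      L  = lcp v₁ v₂
      L′ = lcp (v₁ ++ w₁) (v₂ ++ w₂)
      D  = dist v₁ v₂
      D′ = dist (v₁ ++ w₁) (v₂ ++ w₂)

      D′+2L′≡D+2L+B : D′ + 2 * L′ ≡ D + 2 * L + B
      D′+2L′≡D+2L+B = begin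
        D′ + 2 * L′                                               ≡⟨ dist+2*lcp (v₁ ++ w₁) (v₂ ++ w₂) ⟩
        length (v₁ ++ w₁) + length (v₂ ++ w₂)                     ≡⟨ cong₂ _+_ (length-++ v₁) (length-++ v₂) ⟩
        (length v₁ + length w₁) + (length v₂ + length w₂)         ≡⟨ interchange (length v₁) _ _ _ ⟩
        (length v₁ + length v₂) + B                               ≡⟨ cong (_+ B) (sym (dist+2*lcp v₁ v₂)) ⟩
        D + 2 * L + B                                             ∎
        where
        open ≡-Reasoning
        interchange : ∀ a b c d → (a + b) + (c + d) ≡ (a + c) + (b + d)
        interchange = solve-∀

    dist-++-≤ : dist (v₁ ++ w₁) (v₂ ++ w₂) ≤ dist v₁ v₂ + (length w₁ + length w₂)
    dist-++-≤ = +-cancelʳ-≤ (2 * L′) D′ (D + B) (begin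
      D′ + 2 * L′          ≡⟨ D′+2L′≡D+2L+B ⟩
      D + 2 * L + B        ≤⟨ +-monoˡ-≤ B (+-monoʳ-≤ D (*-monoʳ-≤ 2 (lcpLen-++-mono _ v₁ v₂ w₁ w₂))) ⟩
      D + 2 * L′ + B       ≡⟨ shuffle D (2 * L′) B ⟩
      D + B + 2 * L′       ∎)
      where
      open ≤-Reasoning
      shuffle : ∀ d l b → d + l + b ≡ d + b + l
      shuffle = solve-∀

    dist-≤-++ : dist v₁ v₂ ≤ dist (v₁ ++ w₁) (v₂ ++ w₂) + (length w₁ + length w₂)
    dist-≤-++ = +-cancelʳ-≤ (2 * L + B) D (D′ + B) (begin
      D + (2 * L + B)          ≡⟨ sym (+-assoc D (2 * L) B) ⟩
      D + 2 * L + B            ≡⟨ sym D′+2L′≡D+2L+B ⟩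
      D′ + 2 * L′              ≤⟨ +-monoʳ-≤ D′ (*-monoʳ-≤ 2 (lcpLen-++-≤ _ v₁ v₂ w₁ w₂)) ⟩
      D′ + 2 * (L + B)         ≡⟨ shuffle D′ L B ⟩
      D′ + B + (2 * L + B)     ∎)
      where
      open ≤-Reasoning
      shuffle : ∀ d l b → d + 2 * (l + b) ≡ d + b + (2 * l + b)
      shuffle = solve-∀

∈⇒≤sum : ∀ {A : Set} (f : A → ℕ) {x : A} {xs : List A} → x ∈ xs → f x ≤ sum (map f xs)
∈⇒≤sum f {xs = y ∷ ys} (here refl) = m≤m+n (f y) _
∈⇒≤sum f {xs = y ∷ ys} (there p)   = ≤-trans (∈⇒≤sum f p) (m≤n+m _ (f y))

module _ {A : Set} where

  ∈-─ : ∀ {x z : A} {ys} (p : x ∈ ys) → z ∈ ys → z ≢ x → z ∈ (ys ─ p)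
  ∈-─ (here refl) (here refl) z≢x = contradiction refl z≢x
  ∈-─ (here refl) (there q)   _   = q
  ∈-─ (there p)   (here refl) _   = here refl
  ∈-─ (there p)   (there q)   z≢x = there (∈-─ p q z≢x)

  Unique⇒length≤ : ∀ {xs ys : List A} → Unique xs → xs ⊆ ys → length xs ≤ length ys
  Unique⇒length≤ {[]}     _              _  = z≤n
  Unique⇒length≤ {x ∷ xs} {ys} (x≢xs ∷ u) xs⊆ys =
    subst (suc (length xs) ≤_) (sym (length-removeAt′ ys _))
      (s≤s (Unique⇒length≤ u (λ z∈xs → ∈-─ x∈ys (xs⊆ys (there z∈xs)) (≢-sym (All.lookup x≢xs z∈xs)))))
    where
    x∈ys : x ∈ ys
    x∈ys = xs⊆ys (here refl)

module _ (T : NFT) where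
  open NFT T
  open import Data.List.Membership.DecPropositional (_≟_ {suc nQ}) using (_∈?_)

  Unique⇒length≤#states : ∀ {qs : List State} → Unique qs → length qs ≤ suc nQ
  Unique⇒length≤#states {qs} u =
    subst (length qs ≤_) (length-tabulate {n = suc nQ} (λ q → q))
      (Unique⇒length≤ u (λ {q} _ → ∈-allFin q))

  outputBound : ℕ
  outputBound = sum (map outputsFrom (allFin _))
    where
    outputsOn : State → In → ℕ
    outputsOn q σ = sum (map (λ p → length (proj₂ p)) (δ q σ))
    outputsFrom : State → ℕ
    outputsFrom q = sum (map (outputsOn q) (allFin _))

  transition-output≤ : ∀ {q q′ σ x} → (q′ , x) ∈ δ q σ → length x ≤ outputBound
  transition-output≤ {q} {σ = σ} x∈δ =
    ≤-trans (∈⇒≤sum _ x∈δ) (≤-trans (∈⇒≤sum _ (∈-allFin σ)) (∈⇒≤sum _ (∈-allFin q)))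

  Step-output≤ : ∀ {q b w f} → Step q b w f → length w ≤ length b * outputBound
  Step-output≤ done = z≤n
  Step-output≤ (step {x = x} x∈δ s) =
    subst (_≤ _) (sym (length-++ x)) (+-mono-≤ (transition-output≤ x∈δ) (Step-output≤ s))

  data Trace : State → List In → List Out → State → List State → Set where
    done : ∀ {q} → Trace q [] [] q (q ∷ [])
    step : ∀ {q q′ q″ σ a x u qs} →
           (q′ , x) ∈ δ q σ → Trace q′ a u q″ qs → Trace q (σ ∷ a) (x ++ u) q″ (q ∷ qs)

  Trace⇒Step : ∀ {q a u f qs} → Trace q a u f qs → Step q a u f
  Trace⇒Step done         = done
  Trace⇒Step (step x∈δ t) = step x∈δ (Trace⇒Step t)

  length-Trace : ∀ {q a u f qs} → Trace q a u f qs → length qs ≡ suc (length a)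
  length-Trace done       = refl
  length-Trace (step _ t) = cong suc (length-Trace t)

  record SimpleTrace (q f : State) : Set where
    constructor simpleTrace
    field
      {input}  : List In
      {output} : List Out
      {states} : List State
      trace    : Trace q input output f states
      unique   : Unique states

  suffixFrom : ∀ {p a u f qs q} → Trace p a u f qs → Unique qs → q ∈ qs → SimpleTrace q f
  suffixFrom t@done       u       (here refl)  = simpleTrace t u
  suffixFrom t@(step _ _) u       (here refl)  = simpleTrace t u
  suffixFrom (step _ t)   (_ ∷ u) (there q∈qs) = suffixFrom t u q∈qs

  removeLoops : ∀ {q b w f} → Step q b w f → SimpleTrace q f
  removeLoops done = simpleTrace done ([] ∷ [])
  removeLoops {q} (step x∈δ s) with removeLoops s
  ... | simpleTrace {states = qs} t u with q ∈? qs
  ...   | yes q∈qs = suffixFrom t u q∈qs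
  ...   | no  q∉qs = simpleTrace (step x∈δ t) (¬Any⇒All¬ qs q∉qs ∷ u)

  shortStep : ∀ {q b w f} → Step q b w f →
              ∃₂ λ b′ w′ → Step q b′ w′ f × length b′ ≤ nQ
  shortStep s with removeLoops s
  ... | simpleTrace t u =
    _ , _ , Trace⇒Step t , s≤s⁻¹ (subst (_≤ suc nQ) (length-Trace t) (Unique⇒length≤#states u))

  boundedVariation⇒boundedPrefixDelay : BoundedVariation T → BoundedPrefixDelay T
  boundedVariation⇒boundedPrefixDelay bv =
    let (t , variation≤) = bv (nQ + nQ) in
    t + (nQ * outputBound + nQ * outputBound) ,
    λ q₁ q₂ f₁ f₂ acc₁ acc₂ a _ _ u v₁ v₂ _ _ s₁ s₁′ s₂ s₂′ →
      let (b₁′ , w₁′ , t₁ , |b₁′|≤nQ) = shortStep s₁′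
          (b₂′ , w₂′ , t₂ , |b₂′|≤nQ) = shortStep s₂′
      in ≤-trans (dist-≤-++ v₁ v₂ w₁′ w₂′)
           (+-mono-≤ (variation≤ q₁ q₂ f₁ f₂ acc₁ acc₂ a b₁′ b₂′ u v₁ v₂ w₁′ w₂′ s₁ t₁ s₂ t₂
                        (+-mono-≤ |b₁′|≤nQ |b₂′|≤nQ))
             (+-mono-≤ (≤-trans (Step-output≤ t₁) (*-monoˡ-≤ outputBound |b₁′|≤nQ))
                       (≤-trans (Step-output≤ t₂) (*-monoˡ-≤ outputBound |b₂′|≤nQ))))

  boundedPrefixDelay⇒boundedVariation : BoundedPrefixDelay T → BoundedVariation T
  boundedPrefixDelay⇒boundedVariation (t , delay≤) k =
    t + k * outputBound ,
    λ q₁ q₂ f₁ f₂ acc₁ acc₂ a b₁ b₂ u v₁ v₂ w₁ w₂ s₁ s₁′ s₂ s₂′ |b₁|+|b₂|≤k →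
      ≤-trans (dist-++-≤ v₁ v₂ w₁ w₂)
        (+-mono-≤ (delay≤ q₁ q₂ f₁ f₂ acc₁ acc₂ a b₁ b₂ u v₁ v₂ w₁ w₂ s₁ s₁′ s₂ s₂′)
          (≤-trans (+-mono-≤ (Step-output≤ s₁′) (Step-output≤ s₂′))
            (subst (_≤ k * outputBound) (*-distribʳ-+ outputBound (length b₁) (length b₂))
              (*-monoˡ-≤ outputBound |b₁|+|b₂|≤k))))

lemma2 : (T : NFT) → BoundedVariation T ⇔ BoundedPrefixDelay T
lemma2 T = mk⇔ (boundedVariation⇒boundedPrefixDelay T) (boundedPrefixDelay⇒boundedVariation T)
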